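{- Let $u$ and $v$ be $\beta(1,0)$-trees each with at least one edge, and let $t=u\oplus v$. Then $\mathrm{leaves}\,t=\mathrm{leaves}\,u+\mathrm{leaves}\,v$, $\mathrm{root}\,t=\mathrm{root}\,u+\mathrm{root}\,v$, $\mathrm{lpath}\,t=\mathrm{lpath}\,u$, $\mathrm{rpath}\,t=\mathrm{rpath}\,v$, $\mathrm{lsub}\,t=\mathrm{lsub}\,u$; and if $k\ge 0$ is the largest integer such that $t=(e\oplus\cdots\oplus e)\oplus v'$ ($k$ copies of $e$) for some $\beta(1,0)$-tree $v'$ with at least one edge, then $\mathrm{stem}_{\mathrm{hm}}\,t=k+\mathrm{stem}_{\mathrm{hm}}\,v'$.
   Context: A $\beta(1,0)$-tree is a rooted plane tree with at least one edge whose nodes are labeled by positive integers such that leaves have label 1, the root has label equal to the sum of its children's labels, and every other node has label at most the sum of its children's labels. For such trees $u,v$, $u\oplus v$ is the tree whose root has label $\mathrm{root}(u)+\mathrm{root}(v)$ and whose root subtrees are those of $u$ (in order) followed by those of $v$ (in order); the sum of zero copies is omitted. $e$ denotes the tree with one edge (root label 1, one leaf). Statistics: $\mathrm{leaves}$ = number of leaves; $\mathrm{root}$ = root label; $\mathrm{lpath}$, $\mathrm{rpath}$ = number of edges on the path from the root to the leftmost, resp. rightmost, leaf; $\mathrm{lsub}$ = number of nodes labeled 1 on the left path other than the root. $\mathrm{stem}_{\mathrm{hm}}(t)$: let $\ell_1,\dots,\ell_m$ be the leaves of $t$ from left to right; starting with $j=1$, if no node on the path from $\ell_j$ to the root other than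 $\ell_j$ has (current) label 1, decrease by 1 the labels of all nodes on that path, delete $\ell_j$ and move to $j+1$; the first $j$ for which that path contains a node other than $\ell_j$ with current label 1 is $\mathrm{stem}_{\mathrm{hm}}(t)$. -}

module Defs where

open import Data.Nat using (ℕ; zero; suc; _+_; _∸_; _≤_; _≡ᵇ_)
open import Data.Bool using (Bool; true; false; if_then_else_)
open import Data.List using (List; []; _∷_; _++_; map)
open import Data.Nat.ListAction using (sum)
open import Data.Bool.ListAction using (any)
open import Data.List.Relation.Unary.All using (All)
open import Relation.Binary.PropositionalEquality using (_≡_)

data Tree : Set where
  node : ℕ → List Tree → Tree

label : Tree → ℕ
label (node n _) = n

sumLabels : List Tree → ℕ
sumLabels cs = sum (map label cs)

-- Condition for a non-root node of a β(1,0)-tree (and its subtree):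
-- leaves have label 1; an internal non-root node has a positive label
-- at most the sum of its children's labels.
data Sub : Tree → Set where
  leaf  : Sub (node 1 [])
  inner : ∀ {n c cs} → 1 ≤ n → n ≤ sumLabels (c ∷ cs) → All Sub (c ∷ cs) →
          Sub (node n (c ∷ cs))

data Beta : Tree → Set where
  beta : ∀ {n c cs} → n ≡ sumLabels (c ∷ cs) → All Sub (c ∷ cs) →
         Beta (node n (c ∷ cs))

_⊕_ : Tree → Tree → Tree
node a cs ⊕ node b ds = node (a + b) (cs ++ ds)

infixr 6 _⊕_

e : Tree
e = node 1 (node 1 [] ∷ [])

ePow⊕ : ℕ → Tree → Tree
ePow⊕ zero v = v
ePow⊕ (suc k) v = e ⊕ ePow⊕ k v

mutual
  leaves : Tree → ℕ
  leaves (node _ []) = 1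
  leaves (node _ (c ∷ cs)) = leavesL (c ∷ cs)

  leavesL : List Tree → ℕ
  leavesL [] = 0
  leavesL (c ∷ cs) = leaves c + leavesL cs

root : Tree → ℕ
root = label

lpath : Tree → ℕ
lpath (node _ []) = 0
lpath (node _ (c ∷ _)) = suc (lpath c)

mutual
  rpath : Tree → ℕ
  rpath (node _ []) = 0
  rpath (node _ (c ∷ cs)) = rpathL c cs

  rpathL : Tree → List Tree → ℕ
  rpathL c [] = suc (rpath c)
  rpathL _ (d ∷ ds) = rpathL d ds

isOne : ℕ → ℕ
isOne n = if n ≡ᵇ 1 then 1 else 0

lsubFrom : Tree → ℕ
lsubFrom (node n []) = isOne n
lsubFrom (node n (c ∷ _)) = isOne n + lsubFrom c

lsub : Tree → ℕ
lsub (node _ []) = 0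
lsub (node _ (c ∷ _)) = lsubFrom c

-- stem_hm
-- A node is addressed by a path = list of child indices from the root.

Path : Set
Path = List ℕ

mutual
  leafPaths : Tree → List Path
  leafPaths (node _ []) = [] ∷ []
  leafPaths (node _ (c ∷ cs)) = leafPathsL 0 (c ∷ cs)

  leafPathsL : ℕ → List Tree → List Path
  leafPathsL i [] = []
  leafPathsL i (c ∷ cs) = map (i ∷_) (leafPaths c) ++ leafPathsL (suc i) cs

mutual
  ancLabels : Tree → Path → List ℕ
  ancLabels (node n cs) [] = []
  ancLabels (node n cs) (i ∷ p) = n ∷ ancLabelsL cs i p

  ancLabelsL : List Tree → ℕ → Path → List ℕ
  ancLabelsL [] _ _ = []
  ancLabelsL (c ∷ cs) zero p = ancLabels c p
  ancLabelsL (c ∷ cs) (suc i) p = ancLabelsL cs i p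

mutual
  decPath : Tree → Path → Tree
  decPath (node n cs) [] = node (n ∸ 1) cs
  decPath (node n cs) (i ∷ p) = node (n ∸ 1) (decPathL cs i p)

  decPathL : List Tree → ℕ → Path → List Tree
  decPathL [] _ _ = []
  decPathL (c ∷ cs) zero p = decPath c p ∷ cs
  decPathL (c ∷ cs) (suc i) p = c ∷ decPathL cs i p

-- A processed leaf has label 0 afterwards and is never visited again, so
-- keeping it in place instead of deleting it does not affect the
-- procedure (the leaves are fixed in advance, addresses stay valid).
stemGo : Tree → List Path → ℕ → ℕ
stemGo t [] j = j   -- never reached for β(1,0)-trees
stemGo t (p ∷ ps) j =
  if any (λ x → x ≡ᵇ 1) (ancLabels t p)
  then j
  else stemGo (decPath t p) ps (suc j)

stemHm : Tree → ℕ
stemHm t = stemGo t (leafPaths t) 1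

module Submission where

-- The first five statistics only look at the root, the leftmost child of u and
-- the rightmost child of v, which ⊕ leaves in place.  For stem_hm, write
-- ePow⊕ k v′ as a root with label k + root v′ whose first k children are
-- leaves.  Because root v′ ≥ 1, the root label is never 1 while these k
-- leaves are processed, so each of them passes and is left with label 0;
-- the root label drops to root v′, and the procedure continues exactly as on
-- v′ with the counter shifted by k.

open import Defs
open import Data.Nat using (ℕ; zero; suc; _+_; _≤_; _≡ᵇ_; s≤s; z≤n)
open import Data.Bool using (true; false)
open import Data.Bool.ListAction using (any)
open import Data.Nat.Properties using (+-assoc; +-suc; ≤-trans; m≤m+n)
open import Data.Product using (_×_; _,_)
open import Data.List using ([]; _∷_; _++_; map; replicate; length)
open import Data.List.Properties using (map-++; map-∘)
open import Data.List.Relation.Unary.All using (_∷_)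
open import Relation.Binary.PropositionalEquality
  using (_≡_; refl; sym; trans; cong; cong₂; subst; module ≡-Reasoning)

leavesL-++ : ∀ xs ys → leavesL (xs ++ ys) ≡ leavesL xs + leavesL ys
leavesL-++ []       ys = refl
leavesL-++ (x ∷ xs) ys =
  trans (cong (leaves x +_) (leavesL-++ xs ys)) (sym (+-assoc (leaves x) (leavesL xs) (leavesL ys)))

rpathL-++ : ∀ c cs d ds → rpathL c (cs ++ d ∷ ds) ≡ rpathL d ds
rpathL-++ c []       d ds = refl
rpathL-++ c (x ∷ cs) d ds = rpathL-++ x cs d ds

Sub⇒1≤label : ∀ {t} → Sub t → 1 ≤ label t
Sub⇒1≤label leaf            = s≤s z≤n
Sub⇒1≤label (inner 1≤n _ _) = 1≤n

Beta⇒1≤root : ∀ {t} → Beta t → 1 ≤ root t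
Beta⇒1≤root (beta {c = c} n≡ (sc ∷ _)) =
  subst (1 ≤_) (sym n≡) (≤-trans (Sub⇒1≤label sc) (m≤m+n (label c) _))

stemGo-+ : ∀ t ps k j → stemGo t ps (k + j) ≡ k + stemGo t ps j
stemGo-+ t []       k j = refl
stemGo-+ t (p ∷ ps) k j with any (_≡ᵇ 1) (ancLabels t p)
... | true  = refl
... | false = trans (cong (stemGo (decPath t p) ps) (sym (+-suc k j))) (stemGo-+ (decPath t p) ps k (suc j))

ancLabelsL-++ : ∀ zs ds i p → ancLabelsL (zs ++ ds) (length zs + i) p ≡ ancLabelsL ds i p
ancLabelsL-++ []       ds i p = refl
ancLabelsL-++ (z ∷ zs) ds i p = ancLabelsL-++ zs ds i p

decPathL-++ : ∀ zs ds i p → decPathL (zs ++ ds) (length zs + i) p ≡ zs ++ decPathL ds i p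
decPathL-++ []       ds i p = refl
decPathL-++ (z ∷ zs) ds i p = cong (z ∷_) (decPathL-++ zs ds i p)

shift : ℕ → Path → Path
shift n []      = []
shift n (i ∷ q) = n + i ∷ q

leafPathsL-+ : ∀ n i ds → leafPathsL (n + i) ds ≡ map (shift n) (leafPathsL i ds)
leafPathsL-+ n i []       = refl
leafPathsL-+ n i (c ∷ cs) = begin
  map (n + i ∷_) (leafPaths c) ++ leafPathsL (suc (n + i)) cs
    ≡⟨ cong₂ _++_ (map-∘ (leafPaths c)) (cong (λ m → leafPathsL m cs) (sym (+-suc n i))) ⟩
  map (shift n) (map (i ∷_) (leafPaths c)) ++ leafPathsL (n + suc i) cs
    ≡⟨ cong (map (shift n) (map (i ∷_) (leafPaths c)) ++_) (leafPathsL-+ n (suc i) cs) ⟩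
  map (shift n) (map (i ∷_) (leafPaths c)) ++ map (shift n) (leafPathsL (suc i) cs)
    ≡⟨ sym (map-++ (shift n) (map (i ∷_) (leafPaths c)) (leafPathsL (suc i) cs)) ⟩
  map (shift n) (map (i ∷_) (leafPaths c) ++ leafPathsL (suc i) cs)
    ∎
  where open ≡-Reasoning

-- Extra root children zs in front are invisible to the procedure, provided it
-- only visits addresses shifted past them; only the root label is shared.
stemGo-++ : ∀ zs m ds ps j →
  stemGo (node m (zs ++ ds)) (map (shift (length zs)) ps) j ≡ stemGo (node m ds) ps j
stemGo-++ zs m ds []              j = refl
stemGo-++ zs m ds ([] ∷ ps)       j = stemGo-++ zs _ ds ps (suc j)
stemGo-++ zs m ds ((i ∷ q) ∷ ps) j
  rewrite ancLabelsL-++ zs ds i q | decPathL-++ zs ds i q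
  with any (_≡ᵇ 1) (m ∷ ancLabelsL ds i q)
... | true  = refl
... | false = stemGo-++ zs _ (decPathL ds i q) ps (suc j)

stemGo-e⊕ : ∀ m ds j →
  stemGo (e ⊕ node (suc m) ds) (leafPathsL 0 (node 1 [] ∷ ds)) j
  ≡ stemGo (node (suc m) ds) (leafPathsL 0 ds) (suc j)
-- The root label 2 + m is not 1, so the first leaf passes and keeps label 0.
stemGo-e⊕ m ds j = begin
  stemGo (node (suc m) (node 0 [] ∷ ds)) (leafPathsL 1 ds) (suc j)
    ≡⟨ cong (λ ps → stemGo (node (suc m) (node 0 [] ∷ ds)) ps (suc j)) (leafPathsL-+ 1 0 ds) ⟩
  stemGo (node (suc m) (node 0 [] ∷ ds)) (map (shift 1) (leafPathsL 0 ds)) (suc j)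
    ≡⟨ stemGo-++ (node 0 [] ∷ []) (suc m) ds (leafPathsL 0 ds) (suc j) ⟩
  stemGo (node (suc m) ds) (leafPathsL 0 ds) (suc j)
    ∎
  where open ≡-Reasoning

ePow⊕-node : ∀ k b ds → ePow⊕ k (node (suc b) ds) ≡ node (suc (k + b)) (replicate k (node 1 []) ++ ds)
ePow⊕-node zero    b ds = refl
ePow⊕-node (suc k) b ds = cong (e ⊕_) (ePow⊕-node k b ds)

stemGo-ePow⊕ : ∀ k b ds j →
  stemGo (node (suc (k + b)) (replicate k (node 1 []) ++ ds)) (leafPathsL 0 (replicate k (node 1 []) ++ ds)) j
  ≡ stemGo (node (suc b) ds) (leafPathsL 0 ds) (k + j)
stemGo-ePow⊕ zero    b ds j = refl
stemGo-ePow⊕ (suc k) b ds j =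
  trans (stemGo-e⊕ (k + b) (replicate k (node 1 []) ++ ds) j)
        (trans (stemGo-ePow⊕ k b ds (suc j))
               (cong (stemGo (node (suc b) ds) (leafPathsL 0 ds)) (+-suc k j)))

leafPaths-node : ∀ n xs c cs → leafPaths (node n (xs ++ c ∷ cs)) ≡ leafPathsL 0 (xs ++ c ∷ cs)
leafPaths-node n []       c cs = refl
leafPaths-node n (x ∷ xs) c cs = refl

stemHm-ePow⊕ : ∀ k {v} → Beta v → stemHm (ePow⊕ k v) ≡ k + stemHm v
stemHm-ePow⊕ k {node zero _} βv with Beta⇒1≤root βv
... | ()
stemHm-ePow⊕ k {node (suc b) (c ∷ cs)} _
  rewrite ePow⊕-node k b (c ∷ cs) | leafPaths-node (suc (k + b)) (replicate k (node 1 [])) c cs =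
  trans (stemGo-ePow⊕ k b (c ∷ cs) 1) (stemGo-+ (node (suc b) (c ∷ cs)) (leafPathsL 0 (c ∷ cs)) k 1)

lemma5 : (u v : Tree) → Beta u → Beta v →
    leaves (u ⊕ v) ≡ leaves u + leaves v
    × root (u ⊕ v) ≡ root u + root v
    × lpath (u ⊕ v) ≡ lpath u
    × rpath (u ⊕ v) ≡ rpath v
    × lsub (u ⊕ v) ≡ lsub u
    × ((k : ℕ) (v′ : Tree) → Beta v′ → u ⊕ v ≡ ePow⊕ k v′ →
         ((k′ : ℕ) (v″ : Tree) → Beta v″ → u ⊕ v ≡ ePow⊕ k′ v″ → k′ ≤ k) →
         stemHm (u ⊕ v) ≡ k + stemHm v′)
lemma5 (node a (c ∷ cs)) (node b (d ∷ ds)) (beta _ _) (beta _ _) =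
  leavesL-++ (c ∷ cs) (d ∷ ds) , refl , refl , rpathL-++ c cs d ds , refl ,
  λ k v′ βv′ t≡ _ → trans (cong stemHm t≡) (stemHm-ePow⊕ k βv′)
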